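{- Let $\mathsf H$ be any of the hypersequent calculi $\mathsf{H.N},\mathsf{H.NN},\mathsf{H.NT},\mathsf{H.NW},\mathsf{H.NC},\mathsf{H.NA},\mathsf{H.NNA}$ and let $\mathcal H$ be any hypersequent. Backward proof search for $\mathcal H$ in $\mathsf H$ carried out in accordance with the strategy always terminates after a finite number of steps.
   Context: Language: formulas $A ::= p \mid \bot \mid A\to A \mid A \preccurlyeq A$ over countably many atoms; $\top$ defined as usual. A block $[\Sigma\lhd A]$: finite multiset $\Sigma$ of formulas and formula $A$; a sequent with blocks $\Gamma\Rightarrow\Delta$: $\Gamma$ finite multiset of formulas, $\Delta$ finite multiset of formulas and blocks; a hypersequent: finite multiset $\Gamma_1\Rightarrow\Delta_1\mid\dots\mid\Gamma_n\Rightarrow\Delta_n$ of such (components). Rules ($\mathcal G$ = other components): init: $\mathcal G\mid\Gamma,p\Rightarrow p,\Delta$; $\bot_L$: $\mathcal G\mid\Gamma,\bot\Rightarrow\Delta$; $\to_L$: from $\mathcal G\mid\Gamma,A\to B,B\Rightarrow\Delta$ and $\mathcal G\mid\Gamma,A\to B\Rightarrow\Delta,A$ infer $\mathcal G\mid\Gamma,A\to B\Rightarrow\Delta$; $\to_R$: from $\mathcal G\mid\Gamma,A\Rightarrow\Delta,A\to B,B$ infer $\mathcal G\mid\Gamma\Rightarrow\Delta,A\to B$; $\preccurlyeq_L$: from $\mathcal G\mid\Gamma,A\preccurlyeq B\Rightarrow\Delta,[B,\Sigma\lhd C]$ and $\mathcal G\mid\Gamma,A\preccurlyeq B\Rightarrow\Delta,[\Sigma\lhd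 C],[\Sigma\lhd A]$ infer $\mathcal G\mid\Gamma,A\preccurlyeq B\Rightarrow\Delta,[\Sigma\lhd C]$; $\preccurlyeq_R$: from $\mathcal G\mid\Gamma\Rightarrow\Delta,A\preccurlyeq B,[A\lhd B]$ infer $\mathcal G\mid\Gamma\Rightarrow\Delta,A\preccurlyeq B$; jp: from $\mathcal G\mid\Gamma\Rightarrow\Delta,[\Sigma\lhd A]\mid A\Rightarrow\Sigma$ infer $\mathcal G\mid\Gamma\Rightarrow\Delta,[\Sigma\lhd A]$; N: from $\mathcal G\mid\Gamma\Rightarrow\Delta,[\bot\lhd\top]$ infer $\mathcal G\mid\Gamma\Rightarrow\Delta$; T: from $\mathcal G\mid\Gamma,A\preccurlyeq B\Rightarrow\Delta,B$ and $\mathcal G\mid\Gamma,A\preccurlyeq B\Rightarrow\Delta,[\bot\lhd A]$ infer $\mathcal G\mid\Gamma,A\preccurlyeq B\Rightarrow\Delta$; W: from $\mathcal G\mid\Gamma\Rightarrow\Delta,[\Sigma\lhd A],\Sigma$ infer $\mathcal G\mid\Gamma\Rightarrow\Delta,[\Sigma\lhd A]$; C: from $\mathcal G\mid\Gamma,A\preccurlyeq B\Rightarrow\Delta,B$ and $\mathcal G\mid\Gamma,A\preccurlyeq B,A\Rightarrow\Delta$ infer $\mathcal G\mid\Gamma,A\preccurlyeq B\Rightarrow\Delta$; $\mathrm A_L$: from $\mathcal G\mid\Gamma,A\preccurlyeq B\Rightarrow\Delta\mid\Omega,A\preccurlyeq B\Rightarrow\Theta$ infer $\mathcal G\mid\Gamma,A\preccurlyeq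 B\Rightarrow\Delta\mid\Omega\Rightarrow\Theta$; $\mathrm A_R$: from $\mathcal G\mid\Gamma\Rightarrow\Delta,A\preccurlyeq B\mid\Omega\Rightarrow\Theta,A\preccurlyeq B$ infer $\mathcal G\mid\Gamma\Rightarrow\Delta,A\preccurlyeq B\mid\Omega\Rightarrow\Theta$. $\mathsf{H.N}=\{\mathrm{init},\bot_L,\to_L,\to_R,\preccurlyeq_L,\preccurlyeq_R,\mathrm{jp}\}$; $\mathsf{H.NN}=\mathsf{H.N}+$N; $\mathsf{H.NT}=\mathsf{H.N}+$T; $\mathsf{H.NW}=\mathsf{H.N}+$T,W; $\mathsf{H.NC}=\mathsf{H.N}+$W,C; $\mathsf{H.NA}=\mathsf{H.N}+\mathrm A_L,\mathrm A_R$; $\mathsf{H.NNA}=\mathsf{H.NN}+\mathrm A_L,\mathrm A_R$. Saturation: for a hypersequent $\mathcal H=\Gamma_1\Rightarrow\Delta_1\mid\dots\mid\Gamma_n\Rightarrow\Delta_n$ and component $k$ (write $\mathrm{set}(\Sigma)$ for the underlying set of a multiset), the saturation condition associated with an application of each rule is: (init) $\Gamma_k\cap\Delta_k=\emptyset$; ($\bot_L$) $\bot\notin\Gamma_k$; ($\to_L$) if $A\to B\in\Gamma_k$ then $A\in\Delta_k$ or $B\in\Gamma_k$; ($\to_R$) if $A\to B\in\Delta_k$ then $A\in\Gamma_k$ and $B\in\Delta_k$; ($\preccurlyeq_L$) if $A\preccurlyeq B\in\Gamma_k$ and $[\Sigma\lhd C]\in\Delta_k$ then $B\in\Sigma$ or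 there is $[\Pi\lhd A]\in\Delta_k$ with $\mathrm{set}(\Sigma)\subseteq\mathrm{set}(\Pi)$; ($\preccurlyeq_R$) if $A\preccurlyeq B\in\Delta_k$ then there is $[\Sigma\lhd B]\in\Delta_k$ with $A\in\Sigma$; (jp) if $[\Sigma\lhd A]\in\Delta_k$ then some component $\Gamma_j\Rightarrow\Delta_j$ of $\mathcal H$ has $A\in\Gamma_j$ and $\mathrm{set}(\Sigma)\subseteq\Delta_j$; (N) there is $[\Sigma\lhd\top]\in\Delta_k$ with $\bot\in\Sigma$; (T) if $A\preccurlyeq B\in\Gamma_k$ then $B\in\Delta_k$ or there is $[\Sigma,\bot\lhd A]\in\Delta_k$; (W) if $[\Sigma\lhd A]\in\Delta_k$ then $\mathrm{set}(\Sigma)\subseteq\Delta_k$; (C) if $A\preccurlyeq B\in\Gamma_k$ then $B\in\Delta_k$ or $A\in\Gamma_k$; ($\mathrm A_L$) if $A\preccurlyeq B\in\Gamma_k$ then $A\preccurlyeq B\in\Gamma_j$ for every component $j$; ($\mathrm A_R$) if $A\preccurlyeq B\in\Delta_k$ then $A\preccurlyeq B\in\Delta_j$ for every component $j$. $\mathcal H$ is saturated with respect to a rule application if it satisfies the corresponding condition. The strategy: apply rules backwards (root-first) until no further application is possible, subject to (i) no rule is applied to an initial hypersequent (an instance of init or $\bot_L$), and (ii) a rule application is not allowed if the hypersequent is already saturated with respect to that rule application. -}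

module Defs where

open import Data.Nat using (ℕ)
open import Data.List using (List; []; _∷_; map; _++_)
open import Data.List.Membership.Propositional using (_∈_)
open import Data.Product using (Σ; ∃; _×_)
open import Data.Sum using (_⊎_)
open import Relation.Nullary using (¬_)
open import Induction.WellFounded using (Acc)

infixr 6 _⊃_
infix  7 _≼_

data Fm : Set where
  atom : ℕ → Fm
  falsum : Fm
  _⊃_ : Fm → Fm → Fm
  _≼_ : Fm → Fm → Fm

verum : Fm
verum = falsum ⊃ falsum

-- Right-hand items: formulas and blocks [Σ ◁ A]

data Item : Set where
  fm  : Fm → Item
  blk : List Fm → Fm → Item

-- Sequents with blocks  Γ ⇒ Δ  (multisets represented by lists)
infix 4 _⇒_
record Seq : Set where
  constructor _⇒_
  field
    ant : List Fm
    suc : List Item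

-- Hypersequents: finite multisets of components (represented by lists)
Hyp : Set
Hyp = List Seq

data Pick {A : Set} : A → List A → List A → Set where
  here  : ∀ {x xs} → Pick x (x ∷ xs) xs
  there : ∀ {x y xs ys} → Pick x xs ys → Pick x (y ∷ xs) (y ∷ ys)

_⊆_ : List Fm → List Fm → Set
Σ₀ ⊆ Π = ∀ {x} → x ∈ Σ₀ → x ∈ Π

_⊆ᵣ_ : List Fm → List Item → Set
Σ₀ ⊆ᵣ Δ = ∀ {x} → x ∈ Σ₀ → fm x ∈ Δ

Initial : Hyp → Set
Initial H = ∃ λ Γ → ∃ λ Δ → (Γ ⇒ Δ) ∈ H ×
  ((∃ λ p → atom p ∈ Γ × fm (atom p) ∈ Δ) ⊎ falsum ∈ Γ)

-- Rules with premises (init and ⊥_L have no premises and are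
-- represented by the notion Initial).

data Rule : Set where
  ⊃L ⊃R ≼L ≼R jp N T W C AL AR : Rule

data Calc : Set where
  HN HNN HNT HNW HNC HNA HNNA : Calc

rules : Calc → List Rule
rules HN   = ⊃L ∷ ⊃R ∷ ≼L ∷ ≼R ∷ jp ∷ []
rules HNN  = N ∷ rules HN
rules HNT  = T ∷ rules HN
rules HNW  = T ∷ W ∷ rules HN
rules HNC  = W ∷ C ∷ rules HN
rules HNA  = AL ∷ AR ∷ rules HN
rules HNNA = AL ∷ AR ∷ N ∷ rules HN

-- Inst r H ps : a backward application of rule r to conclusion H with
-- premises ps, such that H is NOT saturated with respect to this
-- application (strategy condition (ii)).

data Inst : Rule → Hyp → List Hyp → Set where
  ⊃L-inst : ∀ {H G Γ Δ A B} → Pick (Γ ⇒ Δ) H G → (A ⊃ B) ∈ Γ →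
    ¬ (fm A ∈ Δ ⊎ B ∈ Γ) →
    Inst ⊃L H (((B ∷ Γ ⇒ Δ) ∷ G) ∷ ((Γ ⇒ fm A ∷ Δ) ∷ G) ∷ [])
  ⊃R-inst : ∀ {H G Γ Δ A B} → Pick (Γ ⇒ Δ) H G → fm (A ⊃ B) ∈ Δ →
    ¬ (A ∈ Γ × fm B ∈ Δ) →
    Inst ⊃R H (((A ∷ Γ ⇒ fm B ∷ Δ) ∷ G) ∷ [])
  ≼L-inst : ∀ {H G Γ Δ Δ' A B Σ₀ C} → Pick (Γ ⇒ Δ) H G → (A ≼ B) ∈ Γ →
    Pick (blk Σ₀ C) Δ Δ' →
    ¬ (B ∈ Σ₀ ⊎ (∃ λ Π → blk Π A ∈ Δ × Σ₀ ⊆ Π)) →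
    Inst ≼L H (((Γ ⇒ blk (B ∷ Σ₀) C ∷ Δ') ∷ G) ∷
               ((Γ ⇒ blk Σ₀ A ∷ Δ) ∷ G) ∷ [])
  ≼R-inst : ∀ {H G Γ Δ A B} → Pick (Γ ⇒ Δ) H G → fm (A ≼ B) ∈ Δ →
    ¬ (∃ λ Σ₀ → blk Σ₀ B ∈ Δ × A ∈ Σ₀) →
    Inst ≼R H (((Γ ⇒ blk (A ∷ []) B ∷ Δ) ∷ G) ∷ [])
  jp-inst : ∀ {H Γ Δ Σ₀ A} → (Γ ⇒ Δ) ∈ H → blk Σ₀ A ∈ Δ →
    ¬ (∃ λ Γⱼ → ∃ λ Δⱼ → (Γⱼ ⇒ Δⱼ) ∈ H × A ∈ Γⱼ × Σ₀ ⊆ᵣ Δⱼ) →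
    Inst jp H (((A ∷ [] ⇒ map fm Σ₀) ∷ H) ∷ [])
  N-inst : ∀ {H G Γ Δ} → Pick (Γ ⇒ Δ) H G →
    ¬ (∃ λ Σ₀ → blk Σ₀ verum ∈ Δ × falsum ∈ Σ₀) →
    Inst N H (((Γ ⇒ blk (falsum ∷ []) verum ∷ Δ) ∷ G) ∷ [])
  T-inst : ∀ {H G Γ Δ A B} → Pick (Γ ⇒ Δ) H G → (A ≼ B) ∈ Γ →
    ¬ (fm B ∈ Δ ⊎ (∃ λ Σ₀ → blk Σ₀ A ∈ Δ × falsum ∈ Σ₀)) →
    Inst T H (((Γ ⇒ fm B ∷ Δ) ∷ G) ∷
              ((Γ ⇒ blk (falsum ∷ []) A ∷ Δ) ∷ G) ∷ [])
  W-inst : ∀ {H G Γ Δ Σ₀ A} → Pick (Γ ⇒ Δ) H G → blk Σ₀ A ∈ Δ →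
    ¬ (Σ₀ ⊆ᵣ Δ) →
    Inst W H (((Γ ⇒ map fm Σ₀ ++ Δ) ∷ G) ∷ [])
  C-inst : ∀ {H G Γ Δ A B} → Pick (Γ ⇒ Δ) H G → (A ≼ B) ∈ Γ →
    ¬ (fm B ∈ Δ ⊎ A ∈ Γ) →
    Inst C H (((Γ ⇒ fm B ∷ Δ) ∷ G) ∷ ((A ∷ Γ ⇒ Δ) ∷ G) ∷ [])
  AL-inst : ∀ {H G G' Γ Δ Ω Θ A B} → Pick (Γ ⇒ Δ) H G →
    Pick (Ω ⇒ Θ) G G' → (A ≼ B) ∈ Γ →
    ¬ ((A ≼ B) ∈ Ω) →
    Inst AL H (((Γ ⇒ Δ) ∷ ((A ≼ B) ∷ Ω ⇒ Θ) ∷ G') ∷ [])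
  AR-inst : ∀ {H G G' Γ Δ Ω Θ A B} → Pick (Γ ⇒ Δ) H G →
    Pick (Ω ⇒ Θ) G G' → fm (A ≼ B) ∈ Δ →
    ¬ (fm (A ≼ B) ∈ Θ) →
    Inst AR H (((Γ ⇒ Δ) ∷ (Ω ⇒ fm (A ≼ B) ∷ Θ) ∷ G') ∷ [])

data Step (L : Calc) (H' H : Hyp) : Set where
  step : ∀ {r ps} → r ∈ rules L → ¬ Initial H → Inst r H ps → H' ∈ ps →
         Step L H' H

-- Termination: every branch of every strategy-conforming backward
-- proof search from H is finite (accessibility w.r.t. Step L).
Terminates : Calc → Hyp → Set
Terminates L H = Acc (Step L) H

-- Every formula occurring during the search lies in the finite set U of subformulas
-- of H and ⊤, and the strategy only applies a rule whose conclusion is not yet saturated,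
-- so each premise records some fact that was missing before: a formula of U in an
-- antecedent or succedent, a block not covered (same conclusion, larger set) by an existing
-- block, a new element in a block, or, for jp, a component justifying a pair (A , Σ) with
-- Σ ⊆ U.  Counting the missing facts of each kind bounds the search: jp may add a component
-- of any weight but decreases the number of unjustified pairs, while every other premise
-- leaves those justified and decreases the summed weight of the components.

module Submission where

open import Defs
open import Data.Nat using (ℕ; suc; _+_; _*_; _≤_; _<_; s≤s)
open import Data.Nat.Properties hiding (_≟_)
import Data.Nat.Properties as ℕ
open import Data.Nat.Induction using (<-wellFounded)
open import Data.Nat.ListAction using (sum)
open import Data.Nat.ListAction.Properties using (sum-↭)
open import Data.Bool using (true; false)
open import Data.List using (List; []; _∷_; map; _++_; length; filter; concatMap; cartesianProduct)
open import Data.List.Relation.Unary.Any as Any using (Any; here; there)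
open import Data.List.Relation.Unary.Any.Properties using (++⁺ʳ)
open import Data.List.Relation.Unary.All as All using (All; []; _∷_)
open import Data.List.Relation.Unary.All.Properties using (++⁺; map⁺; ¬All⇒Any¬)
open import Data.List.Membership.Propositional using (_∈_; _∉_; find; lose)
open import Data.List.Membership.Propositional.Properties
  using (∈-++⁺ˡ; ∈-++⁺ʳ; ∈-++⁻; ∈-map⁺; ∈-filter⁺; ∈-filter⁻; ∈-concatMap⁺; ∈-concatMap⁻; ∈-cartesianProduct⁺)
open import Data.List.Relation.Binary.Permutation.Propositional
  using (_↭_; ↭-refl; ↭-prep; ↭-swap; ↭-trans; ↭-sym)
open import Data.List.Relation.Binary.Permutation.Propositional.Properties
  using (∈-resp-↭; Any-resp-↭; All-resp-↭)
import Data.List.Relation.Binary.Permutation.Propositional.Properties as ↭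
open import Data.Product using (∃; _×_; _,_; proj₁; proj₂; uncurry)
open import Data.Product.Relation.Binary.Lex.Strict using (×-Lex; ×-wellFounded)
open import Data.Sum using (inj₁; inj₂)
open import Data.Empty using (⊥)
open import Function using (_∘_; id)
open import Relation.Nullary using (¬_; Dec; yes; no; does; contradiction)
open import Relation.Nullary.Decidable using (map′; _×-dec_)
open import Relation.Unary using (Decidable)
open import Relation.Binary using (Rel; DecidableEquality)
open import Relation.Binary.PropositionalEquality using (_≡_; refl; cong; cong₂; sym; trans)
open import Induction.WellFounded using (WellFounded; Acc; acc)

_≟_ : DecidableEquality Fm
atom m ≟ atom n = map′ (cong atom) (λ { refl → refl }) (m ℕ.≟ n)
falsum ≟ falsum = yes refl
(A ⊃ B) ≟ (A′ ⊃ B′) = map′ (uncurry (cong₂ _⊃_)) (λ { refl → refl , refl }) (A ≟ A′ ×-dec B ≟ B′)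
(A ≼ B) ≟ (A′ ≼ B′) = map′ (uncurry (cong₂ _≼_)) (λ { refl → refl , refl }) (A ≟ A′ ×-dec B ≟ B′)
atom _  ≟ falsum  = no λ ()
atom _  ≟ (_ ⊃ _) = no λ ()
atom _  ≟ (_ ≼ _) = no λ ()
falsum  ≟ atom _  = no λ ()
falsum  ≟ (_ ⊃ _) = no λ ()
falsum  ≟ (_ ≼ _) = no λ ()
(_ ⊃ _) ≟ atom _  = no λ ()
(_ ⊃ _) ≟ falsum  = no λ ()
(_ ⊃ _) ≟ (_ ≼ _) = no λ ()
(_ ≼ _) ≟ atom _  = no λ ()
(_ ≼ _) ≟ falsum  = no λ ()
(_ ≼ _) ≟ (_ ⊃ _) = no λ ()

open import Data.List.Membership.DecPropositional _≟_ using (_∈?_)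

fm-∈? : ∀ x Δ → Dec (fm x ∈ Δ)
fm-∈? x = Any.any? (fm-≟ x)
  where
  fm-≟ : ∀ x → Decidable (fm x ≡_)
  fm-≟ x (fm y)    = map′ (cong fm) (λ { refl → refl }) (x ≟ y)
  fm-≟ x (blk _ _) = no λ ()

missing : {A : Set} {P : A → Set} → Decidable P → List A → ℕ
missing P? [] = 0
missing P? (x ∷ xs) with P? x
... | yes _ = missing P? xs
... | no  _ = suc (missing P? xs)

missing≤length : {A : Set} {P : A → Set} (P? : Decidable P) (xs : List A) → missing P? xs ≤ length xs
missing≤length P? [] = ≤-refl
missing≤length P? (x ∷ xs) with P? x
... | yes _ = m≤n⇒m≤1+n (missing≤length P? xs)
... | no  _ = s≤s (missing≤length P? xs)

module _ {A : Set} {P Q : A → Set} (P? : Decidable P) (Q? : Decidable Q)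
         (P⇒Q : ∀ {x} → P x → Q x) where

  missing-anti : ∀ xs → missing Q? xs ≤ missing P? xs
  missing-anti [] = ≤-refl
  missing-anti (x ∷ xs) with P? x | Q? x
  ... | yes p | no ¬q = contradiction (P⇒Q p) ¬q
  ... | yes _ | yes _ = missing-anti xs
  ... | no _  | yes _ = m≤n⇒m≤1+n (missing-anti xs)
  ... | no _  | no _  = s≤s (missing-anti xs)

  missing-anti-< : ∀ {y xs} → y ∈ xs → ¬ P y → Q y → missing Q? xs < missing P? xs
  missing-anti-< {xs = x ∷ xs} (here refl) ¬p q with P? x | Q? x
  ... | yes p | _     = contradiction p ¬p
  ... | no _  | no ¬q = contradiction q ¬q
  ... | no _  | yes _ = s≤s (missing-anti xs)
  missing-anti-< {xs = x ∷ xs} (there y∈xs) ¬p q with P? x | Q? x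
  ... | yes p | no ¬q = contradiction (P⇒Q p) ¬q
  ... | yes _ | yes _ = missing-anti-< y∈xs ¬p q
  ... | no _  | yes _ = m<n⇒m<1+n (missing-anti-< y∈xs ¬p q)
  ... | no _  | no _  = s≤s (missing-anti-< y∈xs ¬p q)

sublists : {A : Set} → List A → List (List A)
sublists [] = [] ∷ []
sublists (x ∷ xs) = map (x ∷_) (sublists xs) ++ sublists xs

filter-∈-sublists : {A : Set} {P : A → Set} (P? : Decidable P) (xs : List A) →
  filter P? xs ∈ sublists xs
filter-∈-sublists P? [] = here refl
filter-∈-sublists P? (x ∷ xs) with does (P? x)
... | true  = ∈-++⁺ˡ (∈-map⁺ (x ∷_) (filter-∈-sublists P? xs))
... | false = ∈-++⁺ʳ _ (filter-∈-sublists P? xs)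

module _ {A : Set} where

  pick-↭ : {x : A} {xs ys : List A} → Pick x xs ys → xs ↭ x ∷ ys
  pick-↭ here = ↭-refl
  pick-↭ {x} (there {y = y} p) = ↭-trans (↭-prep y (pick-↭ p)) (↭-swap y x ↭-refl)

  pick-∈ : {x : A} {xs ys : List A} → Pick x xs ys → x ∈ xs
  pick-∈ p = ∈-resp-↭ (↭-sym (pick-↭ p)) (here refl)

  pick₂-↭ : {x y : A} {xs ys zs : List A} → Pick x xs ys → Pick y ys zs → xs ↭ y ∷ x ∷ zs
  pick₂-↭ {x} {y} p q = ↭-trans (pick-↭ p) (↭-trans (↭-prep x (pick-↭ q)) (↭-swap x y ↭-refl))

_≺_ : Rel (ℕ × ℕ) _
_≺_ = ×-Lex _≡_ _<_ _<_

≺-wellFounded : WellFounded _≺_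
≺-wellFounded = ×-wellFounded <-wellFounded <-wellFounded

≤×<⇒≺ : ∀ {a′ a b′ b} → a′ ≤ a → b′ < b → (a′ , b′) ≺ (a , b)
≤×<⇒≺ a′≤a b′<b with m≤n⇒m<n∨m≡n a′≤a
... | inj₁ a′<a = inj₁ a′<a
... | inj₂ a′≡a = inj₂ (a′≡a , b′<b)

*-+-<-lex : ∀ k {u′ u s′ s} → u′ < u → s′ ≤ k + s → suc k * u′ + s′ < suc k * u + s
*-+-<-lex k {u′} {u} {s′} {s} u′<u s′≤k+s = begin-strict
  suc k * u′ + s′          ≤⟨ +-monoʳ-≤ (suc k * u′) s′≤k+s ⟩
  suc k * u′ + (k + s)     <⟨ +-monoʳ-< (suc k * u′) (n<1+n (k + s)) ⟩
  suc k * u′ + (suc k + s) ≡⟨ +-shuffle ⟩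
  suc k * suc u′ + s       ≤⟨ +-monoˡ-≤ s (*-monoʳ-≤ (suc k) u′<u) ⟩
  suc k * u + s            ∎
  where
  open ≤-Reasoning
  +-shuffle : suc k * u′ + (suc k + s) ≡ suc k * suc u′ + s
  +-shuffle = trans (sym (+-assoc (suc k * u′) (suc k) s))
                    (cong (_+ s) (trans (+-comm (suc k * u′) (suc k)) (sym (*-suc (suc k) u′))))

subformulas : Fm → List Fm
subformulas (atom n) = atom n ∷ []
subformulas falsum   = falsum ∷ []
subformulas (A ⊃ B)  = (A ⊃ B) ∷ subformulas A ++ subformulas B
subformulas (A ≼ B)  = (A ≼ B) ∷ subformulas A ++ subformulas B

∈-subformulas : ∀ A → A ∈ subformulas A
∈-subformulas (atom n) = here refl
∈-subformulas falsum   = here refl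
∈-subformulas (A ⊃ B)  = here refl
∈-subformulas (A ≼ B)  = here refl

subformulas-trans : ∀ {x y} z → x ∈ subformulas z → y ∈ subformulas x → y ∈ subformulas z
subformulas-++-trans : ∀ {x y} A B → x ∈ subformulas A ++ subformulas B →
  y ∈ subformulas x → y ∈ subformulas A ++ subformulas B

subformulas-trans (atom n) (here refl) y∈x = y∈x
subformulas-trans falsum   (here refl) y∈x = y∈x
subformulas-trans (A ⊃ B)  (here refl) y∈x = y∈x
subformulas-trans (A ⊃ B)  (there x∈) y∈x = there (subformulas-++-trans A B x∈ y∈x)
subformulas-trans (A ≼ B)  (here refl) y∈x = y∈x
subformulas-trans (A ≼ B)  (there x∈) y∈x = there (subformulas-++-trans A B x∈ y∈x)

subformulas-++-trans A B x∈ y∈x with ∈-++⁻ (subformulas A) x∈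
... | inj₁ x∈A = ∈-++⁺ˡ (subformulas-trans A x∈A y∈x)
... | inj₂ x∈B = ∈-++⁺ʳ (subformulas A) (subformulas-trans B x∈B y∈x)

SubformulaClosed : List Fm → Set
SubformulaClosed U = ∀ {x y} → x ∈ U → y ∈ subformulas x → y ∈ U

concatMap-subformulas-closed : ∀ xs → SubformulaClosed (concatMap subformulas xs)
concatMap-subformulas-closed xs x∈ y∈x =
  ∈-concatMap⁺ subformulas
    (Any.map (λ {z} x∈z → subformulas-trans z x∈z y∈x) (∈-concatMap⁻ subformulas {xs} x∈))

itemFormulas : Item → List Fm
itemFormulas (fm x)    = x ∷ []
itemFormulas (blk Π A) = A ∷ Π

seqFormulas : Seq → List Fm
seqFormulas (Γ ⇒ Δ) = Γ ++ concatMap itemFormulas Δ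

hypFormulas : Hyp → List Fm
hypFormulas = concatMap seqFormulas

module Measure (U : List Fm) (closed : SubformulaClosed U) (⊤∈U : verum ∈ U) where

  ⊃-parts : ∀ {A B} → (A ⊃ B) ∈ U → A ∈ U × B ∈ U
  ⊃-parts {A} {B} A⊃B∈U =
    closed A⊃B∈U (there (∈-++⁺ˡ (∈-subformulas A))) ,
    closed A⊃B∈U (there (∈-++⁺ʳ (subformulas A) (∈-subformulas B)))

  ≼-parts : ∀ {A B} → (A ≼ B) ∈ U → A ∈ U × B ∈ U
  ≼-parts {A} {B} A≼B∈U =
    closed A≼B∈U (there (∈-++⁺ˡ (∈-subformulas A))) ,
    closed A≼B∈U (there (∈-++⁺ʳ (subformulas A) (∈-subformulas B)))

  ⊥∈U : falsum ∈ U
  ⊥∈U = proj₁ (⊃-parts ⊤∈U)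

  ItemInU : Item → Set
  ItemInU (fm x)    = x ∈ U
  ItemInU (blk Π A) = A ∈ U × All (_∈ U) Π

  InU : Seq → Set
  InU (Γ ⇒ Δ) = All (_∈ U) Γ × All ItemInU Δ

  AllInU : Hyp → Set
  AllInU = All InU

  item-InU : ∀ i → (∀ {x} → x ∈ itemFormulas i → x ∈ U) → ItemInU i
  item-InU (fm x)    ⊆U = ⊆U (here refl)
  item-InU (blk Π A) ⊆U = ⊆U (here refl) , All.tabulate (⊆U ∘ there)

  seq-InU : ∀ c → (∀ {x} → x ∈ seqFormulas c → x ∈ U) → InU c
  seq-InU (Γ ⇒ Δ) ⊆U =
    All.tabulate (⊆U ∘ ∈-++⁺ˡ) ,
    All.tabulate (λ {i} i∈Δ →
      item-InU i (λ x∈i → ⊆U (∈-++⁺ʳ Γ (∈-concatMap⁺ itemFormulas (lose i∈Δ x∈i)))))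

  hyp-AllInU : ∀ H → (∀ {x} → x ∈ hypFormulas H → x ∈ U) → AllInU H
  hyp-AllInU H ⊆U =
    All.tabulate (λ {c} c∈H → seq-InU c (λ x∈c → ⊆U (∈-concatMap⁺ seqFormulas (lose c∈H x∈c))))

  antecedent∈U : ∀ {H Γ Δ x} → AllInU H → (Γ ⇒ Δ) ∈ H → x ∈ Γ → x ∈ U
  antecedent∈U inv c∈H = All.lookup (proj₁ (All.lookup inv c∈H))

  succedent∈U : ∀ {H Γ Δ i} → AllInU H → (Γ ⇒ Δ) ∈ H → i ∈ Δ → ItemInU i
  succedent∈U inv c∈H = All.lookup (proj₂ (All.lookup inv c∈H))

  absent : List Fm → ℕ
  absent Π = missing (_∈? Π) U

  absentᶠ : List Item → ℕ
  absentᶠ Δ = missing (λ x → fm-∈? x Δ) U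

  Candidate : Set
  Candidate = Fm × List Fm

  -- A set Σ ⊆ U is represented by the sublist  trace Σ  of U, so finitely many
  -- candidates (A , Σ) cover all blocks and all jp-requirements up to set equality.
  candidates : List Candidate
  candidates = cartesianProduct U (sublists U)

  trace : List Fm → List Fm
  trace Σ₀ = filter (_∈? Σ₀) U

  trace-candidate : ∀ {A} Σ₀ → A ∈ U → (A , trace Σ₀) ∈ candidates
  trace-candidate Σ₀ A∈U = ∈-cartesianProduct⁺ A∈U (filter-∈-sublists (_∈? Σ₀) U)

  trace-⊆ : ∀ Σ₀ → All (_∈ Σ₀) (trace Σ₀)
  trace-⊆ Σ₀ = All.tabulate (proj₂ ∘ ∈-filter⁻ (_∈? Σ₀) {xs = U})

  lookup-trace : ∀ {P : Fm → Set} {Σ₀} → All (_∈ U) Σ₀ → All P (trace Σ₀) →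
    ∀ {x} → x ∈ Σ₀ → P x
  lookup-trace {Σ₀ = Σ₀} Σ₀⊆U P-trace x∈Σ₀ =
    All.lookup P-trace (∈-filter⁺ (_∈? Σ₀) (All.lookup Σ₀⊆U x∈Σ₀) x∈Σ₀)

  Covers : Candidate → Item → Set
  Covers _       (fm _)    = ⊥
  Covers (A , S) (blk Π A′) = A′ ≡ A × All (_∈ Π) S

  covers? : ∀ p → Decidable (Covers p)
  covers? _       (fm _)    = no λ ()
  covers? (A , S) (blk Π A′) = A′ ≟ A ×-dec All.all? (_∈? Π) S

  Covered : List Item → Candidate → Set
  Covered Δ p = Any (Covers p) Δ

  uncovered : List Item → ℕ
  uncovered Δ = missing (λ p → Any.any? (covers? p) Δ) candidates

  slackOf : Item → ℕ
  slackOf (fm _)    = 0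
  slackOf (blk Π _) = absent Π

  slack : List Item → ℕ
  slack Δ = sum (map slackOf Δ)

  -- Adding a block uncovers one candidate less but may add up to  length U  to the slack.
  blockWeight : List Item → ℕ
  blockWeight Δ = suc (length U) * uncovered Δ + slack Δ

  sucWeight : List Item → ℕ
  sucWeight Δ = absentᶠ Δ + blockWeight Δ

  weight : Seq → ℕ
  weight (Γ ⇒ Δ) = absent Γ + sucWeight Δ

  Justifies : Candidate → Seq → Set
  Justifies (A , S) (Γ ⇒ Δ) = A ∈ Γ × All (λ x → fm x ∈ Δ) S

  justifies? : ∀ p → Decidable (Justifies p)
  justifies? (A , S) (Γ ⇒ Δ) = A ∈? Γ ×-dec All.all? (λ x → fm-∈? x Δ) S

  Justified : Hyp → Candidate → Set
  Justified H p = Any (Justifies p) H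

  unjustified : Hyp → ℕ
  unjustified H = missing (λ p → Any.any? (justifies? p) H) candidates

  μ : Hyp → ℕ × ℕ
  μ H = unjustified H , sum (map weight H)

  absent-∷-≤ : ∀ {x} Γ → absent (x ∷ Γ) ≤ absent Γ
  absent-∷-≤ Γ = missing-anti (_∈? Γ) (_∈? _) there U

  absent-∷-< : ∀ {x Γ} → x ∈ U → x ∉ Γ → absent (x ∷ Γ) < absent Γ
  absent-∷-< {Γ = Γ} x∈U x∉Γ = missing-anti-< (_∈? Γ) (_∈? _) there x∈U x∉Γ (here refl)

  absentᶠ-anti : ∀ {Δ Δ′} → (∀ {x} → fm x ∈ Δ → fm x ∈ Δ′) → absentᶠ Δ′ ≤ absentᶠ Δ
  absentᶠ-anti fm⊆ = missing-anti (λ x → fm-∈? x _) (λ x → fm-∈? x _) fm⊆ U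

  absentᶠ-anti-< : ∀ {Δ Δ′ x} → (∀ {x} → fm x ∈ Δ → fm x ∈ Δ′) →
    x ∈ U → fm x ∉ Δ → fm x ∈ Δ′ → absentᶠ Δ′ < absentᶠ Δ
  absentᶠ-anti-< fm⊆ = missing-anti-< (λ x → fm-∈? x _) (λ x → fm-∈? x _) fm⊆

  uncovered-anti : ∀ {Δ Δ′} → (∀ {p} → Covered Δ p → Covered Δ′ p) → uncovered Δ′ ≤ uncovered Δ
  uncovered-anti cov⊆ =
    missing-anti (λ p → Any.any? (covers? p) _) (λ p → Any.any? (covers? p) _) cov⊆ candidates

  uncovered-new-block : ∀ {A Σ₀ Δ} → A ∈ U → All (_∈ U) Σ₀ →
    ¬ (∃ λ Π → blk Π A ∈ Δ × Σ₀ ⊆ Π) → uncovered (blk Σ₀ A ∷ Δ) < uncovered Δ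
  uncovered-new-block {A} {Σ₀} {Δ} A∈U Σ₀⊆U unsat =
    missing-anti-< (λ p → Any.any? (covers? p) _) (λ p → Any.any? (covers? p) _) there
      (trace-candidate Σ₀ A∈U) not-covered (here (refl , trace-⊆ Σ₀))
    where
    not-covered : ¬ Covered Δ (A , trace Σ₀)
    not-covered cov with find cov
    ... | fm _    , _     , ()
    ... | blk Π _ , b∈Δ , (refl , tr⊆Π) = unsat (Π , b∈Δ , lookup-trace Σ₀⊆U tr⊆Π)

  blockWeight-anti : ∀ {Δ Δ′} → (∀ {p} → Covered Δ p → Covered Δ′ p) →
    slack Δ′ ≤ slack Δ → blockWeight Δ′ ≤ blockWeight Δ
  blockWeight-anti cov⊆ slack≤ = +-mono-≤ (*-monoʳ-≤ (suc (length U)) (uncovered-anti cov⊆)) slack≤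

  sucWeight-fm-≤ : ∀ {x Δ} → sucWeight (fm x ∷ Δ) ≤ sucWeight Δ
  sucWeight-fm-≤ = +-mono-≤ (absentᶠ-anti there) (blockWeight-anti there ≤-refl)

  sucWeight-fm-< : ∀ {x Δ} → x ∈ U → fm x ∉ Δ → sucWeight (fm x ∷ Δ) < sucWeight Δ
  sucWeight-fm-< x∈U x∉Δ =
    +-mono-<-≤ (absentᶠ-anti-< there x∈U x∉Δ (here refl)) (blockWeight-anti there ≤-refl)

  slack-fms : ∀ S Δ → slack (map fm S ++ Δ) ≡ slack Δ
  slack-fms []      Δ = refl
  slack-fms (x ∷ S) Δ = slack-fms S Δ

  sucWeight-fms-< : ∀ {x S Δ} → x ∈ S → x ∈ U → fm x ∉ Δ → sucWeight (map fm S ++ Δ) < sucWeight Δ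
  sucWeight-fms-< {S = S} {Δ} x∈S x∈U x∉Δ =
    +-mono-<-≤ (absentᶠ-anti-< (∈-++⁺ʳ (map fm S)) x∈U x∉Δ (∈-++⁺ˡ (∈-map⁺ fm x∈S)))
               (blockWeight-anti (++⁺ʳ (map fm S)) (≤-reflexive (slack-fms S Δ)))

  sucWeight-blk-< : ∀ {A Σ₀ Δ} → A ∈ U → All (_∈ U) Σ₀ →
    ¬ (∃ λ Π → blk Π A ∈ Δ × Σ₀ ⊆ Π) → sucWeight (blk Σ₀ A ∷ Δ) < sucWeight Δ
  sucWeight-blk-< {Σ₀ = Σ₀} A∈U Σ₀⊆U unsat =
    +-mono-≤-< (absentᶠ-anti there)
      (*-+-<-lex (length U) (uncovered-new-block A∈U Σ₀⊆U unsat)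
                            (+-monoˡ-≤ _ (missing≤length (_∈? Σ₀) U)))

  sucWeight-grow-< : ∀ {A B Σ₀ Δ Δ′} → B ∈ U → B ∉ Σ₀ → Pick (blk Σ₀ A) Δ Δ′ →
    sucWeight (blk (B ∷ Σ₀) A ∷ Δ′) < sucWeight Δ
  sucWeight-grow-< {A} {B} {Σ₀} {Δ} {Δ′} B∈U B∉Σ₀ pk =
    +-mono-≤-< (absentᶠ-anti fm⊆)
               (+-mono-≤-< (*-monoʳ-≤ (suc (length U)) (uncovered-anti cov⊆)) slack<)
    where
    Δ↭ : Δ ↭ blk Σ₀ A ∷ Δ′
    Δ↭ = pick-↭ pk
    fm⊆ : ∀ {x} → fm x ∈ Δ → fm x ∈ blk (B ∷ Σ₀) A ∷ Δ′
    fm⊆ x∈Δ with ∈-resp-↭ Δ↭ x∈Δ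
    ... | there x∈Δ′ = there x∈Δ′
    cov⊆ : ∀ {p} → Covered Δ p → Covered (blk (B ∷ Σ₀) A ∷ Δ′) p
    cov⊆ cov with Any-resp-↭ Δ↭ cov
    ... | here (refl , S⊆Σ₀) = here (refl , All.map there S⊆Σ₀)
    ... | there cov′         = there cov′
    slack< : slack (blk (B ∷ Σ₀) A ∷ Δ′) < slack Δ
    slack< = begin-strict
      absent (B ∷ Σ₀) + slack Δ′ <⟨ +-monoˡ-< (slack Δ′) (absent-∷-< B∈U B∉Σ₀) ⟩
      absent Σ₀ + slack Δ′       ≡⟨ sum-↭ (↭.map⁺ slackOf (↭-sym Δ↭)) ⟩
      slack Δ                    ∎
      where open ≤-Reasoning

  record _⊑_ (c c′ : Seq) : Set where
    field
      ant⊆ : Seq.ant c ⊆ Seq.ant c′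
      fm⊆  : ∀ {x} → fm x ∈ Seq.suc c → fm x ∈ Seq.suc c′

  ⊑-refl : ∀ {c} → c ⊑ c
  ⊑-refl = record { ant⊆ = id ; fm⊆ = id }

  justifies-mono : ∀ {p c c′} → c ⊑ c′ → Justifies p c → Justifies p c′
  justifies-mono c⊑c′ (A∈Γ , S⊆Δ) = _⊑_.ant⊆ c⊑c′ A∈Γ , All.map (_⊑_.fm⊆ c⊑c′) S⊆Δ

  unjustified-anti : ∀ {H H′} → (∀ {c} → c ∈ H → ∃ λ c′ → c′ ∈ H′ × c ⊑ c′) →
    unjustified H′ ≤ unjustified H
  unjustified-anti {H} {H′} dominated =
    missing-anti (λ p → Any.any? (justifies? p) H) (λ p → Any.any? (justifies? p) H′)
      justified′ candidates
    where
    justified′ : ∀ {p} → Justified H p → Justified H′ p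
    justified′ j with find j
    ... | c , c∈H , jc with dominated c∈H
    ... | c′ , c′∈H′ , c⊑c′ = lose c′∈H′ (justifies-mono c⊑c′ jc)

  record _⋖_ (c′ c : Seq) : Set where
    field
      dominates : c ⊑ c′
      lighter   : weight c′ < weight c
      keeps-InU : InU c → InU c′

  Descends : Hyp → Hyp → Set
  Descends H′ H = μ H′ ≺ μ H × AllInU H′

  replace : ∀ {H G H′ c c′} → AllInU H → H ↭ c ∷ G → H′ ↭ c′ ∷ G → c′ ⋖ c → Descends H′ H
  replace {H} {G} {H′} {c} {c′} inv H↭ H′↭ c′⋖c =
    ≤×<⇒≺ (unjustified-anti dominated) total< ,
    All-resp-↭ (↭-sym H′↭) (keeps-InU (All.head cG-InU) ∷ All.tail cG-InU)
    where
    open _⋖_ c′⋖c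
    cG-InU : AllInU (c ∷ G)
    cG-InU = All-resp-↭ H↭ inv
    dominated : ∀ {d} → d ∈ H → ∃ λ d′ → d′ ∈ H′ × d ⊑ d′
    dominated d∈H with ∈-resp-↭ H↭ d∈H
    ... | here refl = c′ , ∈-resp-↭ (↭-sym H′↭) (here refl) , dominates
    ... | there d∈G = _ , ∈-resp-↭ (↭-sym H′↭) (there d∈G) , ⊑-refl
    total< : sum (map weight H′) < sum (map weight H)
    total< = begin-strict
      sum (map weight H′)          ≡⟨ sum-↭ (↭.map⁺ weight H′↭) ⟩
      weight c′ + sum (map weight G) <⟨ +-monoˡ-< _ lighter ⟩
      weight c + sum (map weight G)  ≡⟨ sum-↭ (↭.map⁺ weight (↭-sym H↭)) ⟩
      sum (map weight H)           ∎
      where open ≤-Reasoning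

  replace-picked : ∀ {H G c c′} → AllInU H → Pick c H G → c′ ⋖ c → Descends (c′ ∷ G) H
  replace-picked inv p = replace inv (pick-↭ p) ↭-refl

  replace-picked₂ : ∀ {H G G′ c₀ c c′} → AllInU H → Pick c₀ H G → Pick c G G′ → c′ ⋖ c →
    Descends (c₀ ∷ c′ ∷ G′) H
  replace-picked₂ inv p q = replace inv (pick₂-↭ p q) (↭-swap _ _ ↭-refl)

  add-component : ∀ {H A Σ₀} → AllInU H → A ∈ U → All (_∈ U) Σ₀ →
    ¬ (∃ λ Γⱼ → ∃ λ Δⱼ → (Γⱼ ⇒ Δⱼ) ∈ H × A ∈ Γⱼ × Σ₀ ⊆ᵣ Δⱼ) →
    Descends ((A ∷ [] ⇒ map fm Σ₀) ∷ H) H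
  add-component {H} {A} {Σ₀} inv A∈U Σ₀⊆U unsat =
    inj₁ (missing-anti-< (λ p → Any.any? (justifies? p) H) (λ p → Any.any? (justifies? p) _) there
           (trace-candidate Σ₀ A∈U) not-justified
           (here (here refl , All.map (∈-map⁺ fm) (trace-⊆ Σ₀)))) ,
    (A∈U ∷ [] , map⁺ Σ₀⊆U) ∷ inv
    where
    not-justified : ¬ Justified H (A , trace Σ₀)
    not-justified j with find j
    ... | c , c∈H , (A∈Γ , tr⊆Δ) = unsat (_ , _ , c∈H , A∈Γ , lookup-trace Σ₀⊆U tr⊆Δ)

  add-antecedent : ∀ {x Γ Δ} → x ∈ U → x ∉ Γ → (x ∷ Γ ⇒ Δ) ⋖ (Γ ⇒ Δ)
  add-antecedent x∈U x∉Γ = record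
    { dominates = record { ant⊆ = there ; fm⊆ = id }
    ; lighter   = +-monoˡ-< _ (absent-∷-< x∈U x∉Γ)
    ; keeps-InU = λ (Γ-InU , Δ-InU) → x∈U ∷ Γ-InU , Δ-InU
    }

  change-succedent : ∀ {Γ Δ Δ′} → (∀ {x} → fm x ∈ Δ → fm x ∈ Δ′) → sucWeight Δ′ < sucWeight Δ →
    (All ItemInU Δ → All ItemInU Δ′) → (Γ ⇒ Δ′) ⋖ (Γ ⇒ Δ)
  change-succedent {Γ} fm⊆ lighter keeps = record
    { dominates = record { ant⊆ = id ; fm⊆ = fm⊆ }
    ; lighter   = +-monoʳ-< (absent Γ) lighter
    ; keeps-InU = λ (Γ-InU , Δ-InU) → Γ-InU , keeps Δ-InU
    }

  add-succedent : ∀ {x Γ Δ} → x ∈ U → fm x ∉ Δ → (Γ ⇒ fm x ∷ Δ) ⋖ (Γ ⇒ Δ)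
  add-succedent x∈U x∉Δ = change-succedent there (sucWeight-fm-< x∈U x∉Δ) (x∈U ∷_)

  add-antecedent-succedent : ∀ {A B Γ Δ} → A ∈ U → B ∈ U → ¬ (A ∈ Γ × fm B ∈ Δ) →
    (A ∷ Γ ⇒ fm B ∷ Δ) ⋖ (Γ ⇒ Δ)
  add-antecedent-succedent {A} {B} {Γ} {Δ} A∈U B∈U unsat = record
    { dominates = record { ant⊆ = there ; fm⊆ = there }
    ; lighter   = lighter (A ∈? Γ)
    ; keeps-InU = λ (Γ-InU , Δ-InU) → A∈U ∷ Γ-InU , B∈U ∷ Δ-InU
    }
    where
    lighter : Dec (A ∈ Γ) → weight (A ∷ Γ ⇒ fm B ∷ Δ) < weight (Γ ⇒ Δ)
    lighter (yes A∈Γ) = +-mono-≤-< (absent-∷-≤ Γ) (sucWeight-fm-< B∈U λ B∈Δ → unsat (A∈Γ , B∈Δ))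
    lighter (no  A∉Γ) = +-mono-<-≤ (absent-∷-< A∈U A∉Γ) sucWeight-fm-≤

  add-block : ∀ {A Σ₀ Γ Δ} → A ∈ U → All (_∈ U) Σ₀ → ¬ (∃ λ Π → blk Π A ∈ Δ × Σ₀ ⊆ Π) →
    (Γ ⇒ blk Σ₀ A ∷ Δ) ⋖ (Γ ⇒ Δ)
  add-block A∈U Σ₀⊆U unsat = change-succedent there (sucWeight-blk-< A∈U Σ₀⊆U unsat) ((A∈U , Σ₀⊆U) ∷_)

  add-singleton-block : ∀ {A B Γ Δ} → A ∈ U → B ∈ U → ¬ (∃ λ Σ₀ → blk Σ₀ B ∈ Δ × A ∈ Σ₀) →
    (Γ ⇒ blk (A ∷ []) B ∷ Δ) ⋖ (Γ ⇒ Δ)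
  add-singleton-block A∈U B∈U unsat =
    add-block B∈U (A∈U ∷ []) λ (Π , b∈Δ , A⊆Π) → unsat (Π , b∈Δ , A⊆Π (here refl))

  grow-block : ∀ {A B Σ₀ Γ Δ Δ′} → B ∈ U → B ∉ Σ₀ → Pick (blk Σ₀ A) Δ Δ′ →
    (Γ ⇒ blk (B ∷ Σ₀) A ∷ Δ′) ⋖ (Γ ⇒ Δ)
  grow-block {A} {B} {Σ₀} {Δ = Δ} {Δ′} B∈U B∉Σ₀ pk =
    change-succedent fm⊆ (sucWeight-grow-< B∈U B∉Σ₀ pk) (grown ∘ All-resp-↭ (pick-↭ pk))
    where
    fm⊆ : ∀ {x} → fm x ∈ Δ → fm x ∈ blk (B ∷ Σ₀) A ∷ Δ′
    fm⊆ x∈Δ with ∈-resp-↭ (pick-↭ pk) x∈Δ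
    ... | there x∈Δ′ = there x∈Δ′
    grown : All ItemInU (blk Σ₀ A ∷ Δ′) → All ItemInU (blk (B ∷ Σ₀) A ∷ Δ′)
    grown ((A∈U , Σ₀⊆U) ∷ Δ′-InU) = (A∈U , B∈U ∷ Σ₀⊆U) ∷ Δ′-InU

  add-formulas : ∀ {Σ₀ Γ Δ} → All (_∈ U) Σ₀ → ¬ (Σ₀ ⊆ᵣ Δ) → (Γ ⇒ map fm Σ₀ ++ Δ) ⋖ (Γ ⇒ Δ)
  add-formulas {Σ₀} {Δ = Δ} Σ₀⊆U unsat
    with find (¬All⇒Any¬ (λ x → fm-∈? x Δ) Σ₀ (unsat ∘ All.lookup))
  ... | x , x∈Σ₀ , x∉Δ =
    change-succedent (∈-++⁺ʳ (map fm Σ₀)) (sucWeight-fms-< x∈Σ₀ (All.lookup Σ₀⊆U x∈Σ₀) x∉Δ)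
      (++⁺ (map⁺ Σ₀⊆U))

  premises-descend : ∀ {r H ps} → AllInU H → Inst r H ps → All (λ H′ → Descends H′ H) ps
  premises-descend inv (⊃L-inst p A⊃B∈Γ unsat) =
    let (A∈U , B∈U) = ⊃-parts (antecedent∈U inv (pick-∈ p) A⊃B∈Γ) in
    replace-picked inv p (add-antecedent B∈U (unsat ∘ inj₂)) ∷
    replace-picked inv p (add-succedent A∈U (unsat ∘ inj₁)) ∷ []
  premises-descend inv (⊃R-inst p A⊃B∈Δ unsat) =
    let (A∈U , B∈U) = ⊃-parts (succedent∈U inv (pick-∈ p) A⊃B∈Δ) in
    replace-picked inv p (add-antecedent-succedent A∈U B∈U unsat) ∷ []
  premises-descend inv (≼L-inst p A≼B∈Γ pk unsat) =
    let (A∈U , B∈U) = ≼-parts (antecedent∈U inv (pick-∈ p) A≼B∈Γ)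
        (_ , Σ₀⊆U)  = succedent∈U inv (pick-∈ p) (pick-∈ pk) in
    replace-picked inv p (grow-block B∈U (unsat ∘ inj₁) pk) ∷
    replace-picked inv p (add-block A∈U Σ₀⊆U (unsat ∘ inj₂)) ∷ []
  premises-descend inv (≼R-inst p A≼B∈Δ unsat) =
    let (A∈U , B∈U) = ≼-parts (succedent∈U inv (pick-∈ p) A≼B∈Δ) in
    replace-picked inv p (add-singleton-block A∈U B∈U unsat) ∷ []
  premises-descend inv (jp-inst c∈H b∈Δ unsat) =
    let (A∈U , Σ₀⊆U) = succedent∈U inv c∈H b∈Δ in
    add-component inv A∈U Σ₀⊆U unsat ∷ []
  premises-descend inv (N-inst p unsat) =
    replace-picked inv p (add-singleton-block ⊥∈U ⊤∈U unsat) ∷ []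
  premises-descend inv (T-inst p A≼B∈Γ unsat) =
    let (A∈U , B∈U) = ≼-parts (antecedent∈U inv (pick-∈ p) A≼B∈Γ) in
    replace-picked inv p (add-succedent B∈U (unsat ∘ inj₁)) ∷
    replace-picked inv p (add-singleton-block ⊥∈U A∈U (unsat ∘ inj₂)) ∷ []
  premises-descend inv (W-inst p b∈Δ unsat) =
    let (_ , Σ₀⊆U) = succedent∈U inv (pick-∈ p) b∈Δ in
    replace-picked inv p (add-formulas Σ₀⊆U unsat) ∷ []
  premises-descend inv (C-inst p A≼B∈Γ unsat) =
    let (A∈U , B∈U) = ≼-parts (antecedent∈U inv (pick-∈ p) A≼B∈Γ) in
    replace-picked inv p (add-succedent B∈U (unsat ∘ inj₁)) ∷
    replace-picked inv p (add-antecedent A∈U (unsat ∘ inj₂)) ∷ []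
  premises-descend inv (AL-inst p q A≼B∈Γ unsat) =
    replace-picked₂ inv p q (add-antecedent (antecedent∈U inv (pick-∈ p) A≼B∈Γ) unsat) ∷ []
  premises-descend inv (AR-inst p q A≼B∈Δ unsat) =
    replace-picked₂ inv p q (add-succedent (succedent∈U inv (pick-∈ p) A≼B∈Δ) unsat) ∷ []

  accessible : ∀ L {H} → AllInU H → Acc _≺_ (μ H) → Acc (Step L) H
  accessible L inv (acc smaller) = acc λ { (step _ _ inst H′∈ps) →
    let (μ≺ , inv′) = All.lookup (premises-descend inv inst) H′∈ps in
    accessible L inv′ (smaller μ≺) }

  terminates : ∀ L {H} → AllInU H → Terminates L H
  terminates L inv = accessible L inv (≺-wellFounded _)

universe : Hyp → List Fm
universe H = concatMap subformulas (verum ∷ hypFormulas H)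

hypFormulas⊆universe : ∀ H {x} → x ∈ hypFormulas H → x ∈ universe H
hypFormulas⊆universe H {x} x∈H =
  ∈-concatMap⁺ subformulas {xs = verum ∷ hypFormulas H} (there (lose x∈H (∈-subformulas x)))

proposition5p6 : (L : Calc) (H : Hyp) → Terminates L H
proposition5p6 L H = terminates L (hyp-AllInU H (hypFormulas⊆universe H))
  where
  open Measure (universe H) (concatMap-subformulas-closed (verum ∷ hypFormulas H)) (here refl)
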